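{- Let $p$ be a prime and let $\alpha$ be a positive integer not divisible by $p$. For every positive integer $e$ with $p^e>4$, $$\mathrm{u}\big((\alpha p^{e-1})!\big)\equiv(-1)^{p\alpha}\,\mathrm{u}\big((\alpha p^e)!\big)\pmod{p^e}.$$
   Context: For a prime $p$ and a positive integer $n$, $\nu(n)=\nu_p(n)$ denotes the exponent of $p$ in $n$, and $\mathrm{u}(n)=n/p^{\nu(n)}$ denotes the unit part of $n$ with respect to $p$. -}

module Defs where

open import Data.Nat using (ℕ; zero; suc; _+_; _*_; _^_; _%_; _/_)
open import Data.Nat.Properties using (_≟_)
open import Relation.Nullary using (yes; no)

unitAux : ℕ → ℕ → ℕ → ℕ
unitAux p zero    n = n
unitAux p (suc f) zero = zero
unitAux p (suc f) (suc n) with (suc n) % suc (suc p) ≟ 0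
... | yes _ = unitAux p f (suc n / suc (suc p))
... | no _  = suc n

-- u(n) = n / p^{ν_p(n)}, the p-free part of n (for p ≥ 2 and n ≥ 1).
-- Fuel n suffices since each division by p ≥ 2 strictly decreases n.
-- For p ≤ 1 (never used: p is prime) we return n.
unitPart : ℕ → ℕ → ℕ
unitPart zero          n = n
unitPart (suc zero)    n = n
unitPart (suc (suc p)) n = unitAux p n n

{-# OPTIONS --safe #-}
module Submission where

-- Let N = p^e, M = α p^(e-1), and let Π(n) (unitProduct n) be the product of the
-- j < n prime to p.  Removing the multiples of p from (pM)! gives
-- u((pM)!) = Π(pM) · u(M!).  Π is periodic modulo N, so Π(αN) ≡ Π(N)^α, and by the
-- Gauss generalisation of the Wilson theorem Π(N) ≡ (-1)^p (mod N) once N > 4: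
-- pairing every unit with its inverse leaves the product of the square roots of 1,
-- which are ±1 for odd p and ±1, 2^(e-1) ± 1 for p = 2.  Hence
-- u((αN)!) ≡ (-1)^(pα) u(M!) (mod N), and multiplying by (-1)^(pα) gives the claim.

module SignedDivisibility where
  open import Data.Nat.Base as ℕ using (zero; suc; NonZero)
  open import Data.Nat.DivMod using (_%_; _/_; m≡m%n+[m/n]*n)
  open import Data.Integer.Base using (ℤ; +_; -1ℤ; 1ℤ; 0ℤ; _+_; _*_; _-_; -_; _^_)
  open import Data.Integer.Properties using (pos-+; pos-*; ^-*-assoc; *-identityˡ; *-identityʳ)
  open import Data.Integer.Divisibility.Signed using (_∣_; divides; ∣m∣n⇒∣m+n; ∣n⇒∣m*n; ∣m⇒∣m*n)
  open import Data.Integer.Tactic.RingSolver using (solve-∀)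
  open import Relation.Binary.PropositionalEquality

  pos-^ : ∀ m k → + (m ℕ.^ k) ≡ (+ m) ^ k
  pos-^ m zero    = refl
  pos-^ m (suc k) = trans (pos-* m (m ℕ.^ k)) (cong (+ m *_) (pos-^ m k))

  %≡%⇒∣- : ∀ n .{{_ : NonZero n}} a b → a % n ≡ b % n → + n ∣ + a - + b
  %≡%⇒∣- n a b a%n≡b%n = divides (+ (a / n) - + (b / n)) (begin
    + a - + b                                       ≡⟨ cong₂ _-_ (embed a) (embed b) ⟩
    (+ (a % n) + q a) - (+ (b % n) + q b)           ≡⟨ cong (λ r → (+ (a % n) + q a) - (+ r + q b)) a%n≡b%n ⟨
    (+ (a % n) + q a) - (+ (a % n) + q b)           ≡⟨ cancel (+ (a % n)) (+ (a / n)) (+ (b / n)) (+ n) ⟩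
    (+ (a / n) - + (b / n)) * + n                   ∎)
    where
    open ≡-Reasoning
    q : ℕ.ℕ → ℤ
    q x = + (x / n) * + n
    embed : ∀ x → + x ≡ + (x % n) + q x
    embed x = trans (cong +_ (m≡m%n+[m/n]*n x n)) (trans (pos-+ (x % n) _) (cong (_+_ (+ (x % n))) (pos-* (x / n) n)))
    cancel : ∀ r x y n → (r + x * n) - (r + y * n) ≡ (x - y) * n
    cancel = solve-∀

  ∣m-n∣n-o⇒∣m-o : ∀ {n a b c} → n ∣ a - b → n ∣ b - c → n ∣ a - c
  ∣m-n∣n-o⇒∣m-o {n} {a} {b} {c} n∣a-b n∣b-c = subst (n ∣_) (telescope a b c) (∣m∣n⇒∣m+n n∣a-b n∣b-c)
    where
    telescope : ∀ a b c → (a - b) + (b - c) ≡ a - c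
    telescope = solve-∀

  ∣m-n⇒∣mᵏ-nᵏ : ∀ {n a b} k → n ∣ a - b → n ∣ a ^ k - b ^ k
  ∣m-n⇒∣mᵏ-nᵏ zero    _      = divides 0ℤ refl
  ∣m-n⇒∣mᵏ-nᵏ {n} {a} {b} (suc k) n∣a-b =
    subst (n ∣_) (step a b (a ^ k) (b ^ k))
      (∣m∣n⇒∣m+n (∣n⇒∣m*n a (∣m-n⇒∣mᵏ-nᵏ k n∣a-b)) (∣n⇒∣m*n (b ^ k) n∣a-b))
    where
    step : ∀ a b x y → a * (x - y) + y * (a - b) ≡ a * x - b * y
    step = solve-∀

  -1^n*-1^n≡1 : ∀ n → -1ℤ ^ n * -1ℤ ^ n ≡ 1ℤ
  -1^n*-1^n≡1 zero    = refl
  -1^n*-1^n≡1 (suc n) = trans (negate² (-1ℤ ^ n)) (-1^n*-1^n≡1 n)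
    where
    negate² : ∀ s → (-1ℤ * s) * (-1ℤ * s) ≡ s * s
    negate² = solve-∀

  -1^[1+t*2]≡-1 : ∀ t → -1ℤ ^ (1 ℕ.+ t ℕ.* 2) ≡ -1ℤ
  -1^[1+t*2]≡-1 t = begin
    -1ℤ ^ (1 ℕ.+ t ℕ.* 2)            ≡⟨ cong (-1ℤ *_) (^-*-assoc -1ℤ t 2) ⟨
    -1ℤ * (-1ℤ ^ t * (-1ℤ ^ t * 1ℤ)) ≡⟨ cong (λ x → -1ℤ * (-1ℤ ^ t * x)) (*-identityʳ (-1ℤ ^ t)) ⟩
    -1ℤ * (-1ℤ ^ t * -1ℤ ^ t)        ≡⟨ cong (-1ℤ *_) (-1^n*-1^n≡1 t) ⟩
    -1ℤ                              ∎
    where open ≡-Reasoning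

  ∣v-w*u∣w-s⇒∣u-s*v : ∀ {n s u v w} → s * s ≡ 1ℤ → n ∣ v - w * u → n ∣ w - s → n ∣ u - s * v
  ∣v-w*u∣w-s⇒∣u-s*v {n} {s} {u} {v} {w} s²≡1 n∣v-wu n∣w-s =
    subst (n ∣_) u-sv (∣m∣n⇒∣m+n (∣n⇒∣m*n (- s) n∣v-wu) (∣n⇒∣m*n (- s) (∣m⇒∣m*n u n∣w-s)))
    where
    open ≡-Reasoning
    identity : ∀ s u v w → (- s) * (v - w * u) + (- s) * ((w - s) * u) ≡ s * s * u - s * v
    identity = solve-∀
    u-sv : (- s) * (v - w * u) + (- s) * ((w - s) * u) ≡ u - s * v
    u-sv = begin
      (- s) * (v - w * u) + (- s) * ((w - s) * u) ≡⟨ identity s u v w ⟩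
      s * s * u - s * v                           ≡⟨ cong (λ x → x * u - s * v) s²≡1 ⟩
      1ℤ * u - s * v                              ≡⟨ cong (_- s * v) (*-identityˡ u) ⟩
      u - s * v                                   ∎

open import Defs
open import Data.Bool.Base using (if_then_else_)
open import Data.Empty using (⊥-elim)
open import Data.Integer using (+_; -1ℤ; 1ℤ) renaming (_*_ to _*ℤ_; _-_ to _-ℤ_; _^_ to _^ℤ_)
open import Data.Integer.Divisibility using () renaming (_∣_ to _∣ℤ_)
open import Data.Integer.Divisibility.Signed using (divides; ∣⇒∣ᵤ) renaming (_∣_ to _∣ₛ_)
import Data.Integer.Properties as ℤ
open import Data.List.Base using (List; []; _∷_)
open import Data.List.Membership.Propositional using (_∈_; _∉_)
open import Data.List.Relation.Unary.All as All using (All; []; _∷_; lookup)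
import Data.List.Relation.Unary.AllPairs as AllPairs
open import Data.List.Relation.Unary.Any using (here; there)
open import Data.List.Relation.Unary.Linked using ([-]; _∷_)
open import Data.List.Relation.Unary.Linked.Properties using (Linked⇒AllPairs)
open import Data.List.Relation.Unary.Unique.Propositional using (Unique; _∷_)
open import Data.Nat
open import Data.Nat.Coprimality using (Coprime; coprime-Bézout; coprime-divisor)
import Data.Nat.Coprimality as Coprime
open import Data.Nat.DivMod
open import Data.Nat.Divisibility
open import Data.Nat.GCD using (module Bézout)
open import Data.Nat.Induction using (<-rec)
open import Data.Nat.ListAction using (product)
open import Data.Nat.Primality using (Prime; prime[2]; euclidsLemma; prime⇒irreducible)
open import Data.Nat.Properties
open import Algebra.Properties.CommutativeSemigroup *-commutativeSemigroup
  using (interchange; x∙yz≈y∙xz; x∙yz≈yx∙z; x∙yz≈xz∙y)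
open import Data.Nat.Tactic.RingSolver using (solve-∀)
open import Data.Product using (∃-syntax; ∃₂; _×_; _,_; proj₁)
open import Data.Sum using (_⊎_; inj₁; inj₂)
open import Function.Base using (_∘_; _∘′_)
open import Level using (0ℓ)
open import Relation.Binary.Bundles using (Setoid)
import Relation.Binary.Construct.On as On
open import Relation.Binary.PropositionalEquality
import Relation.Binary.Reasoning.Setoid as SetoidReasoning
open import Relation.Nullary using (¬_; Dec; does; yes; no; ¬?; _×-dec_)
open import Relation.Nullary.Decidable using (dec-true; dec-false)
open import Relation.Unary using (Pred; Decidable)
open SignedDivisibility


selected : {A : Set} → Dec A → ℕ → ℕ
selected A? x = if does A? then x else 1

∏< : ℕ → (ℕ → ℕ) → ℕ
∏< zero    f = 1
∏< (suc n) f = f n * ∏< n f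

∏<-cong : ∀ n {f g} → (∀ {j} → j < n → f j ≡ g j) → ∏< n f ≡ ∏< n g
∏<-cong zero    f≡g = refl
∏<-cong (suc n) f≡g = cong₂ _*_ (f≡g ≤-refl) (∏<-cong n (f≡g ∘′ m<n⇒m<1+n))

∏<-+ : ∀ a n f → ∏< (a + n) f ≡ ∏< n (λ j → f (a + j)) * ∏< a f
∏<-+ a zero    f rewrite +-identityʳ a = sym (*-identityˡ _)
∏<-+ a (suc n) f rewrite +-suc a n | ∏<-+ a n f = sym (*-assoc (f (a + n)) _ _)

module Modulo (N : ℕ) .{{_ : NonZero N}} where

  infix 4 _≈_
  _≈_ : ℕ → ℕ → Set
  a ≈ b = a % N ≡ b % N

  ≈-setoid : Setoid _ _
  ≈-setoid = On.setoid (setoid ℕ) (_% N)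

  open Setoid ≈-setoid public using () renaming (refl to ≈-refl; sym to ≈-sym; trans to ≈-trans; reflexive to ≈-reflexive)
  module ≈-Reasoning = SetoidReasoning ≈-setoid

  *-cong : ∀ {a b c d} → a ≈ b → c ≈ d → a * c ≈ b * d
  *-cong {a} {b} {c} {d} a≈b c≈d = begin
    (a * c) % N             ≡⟨ %-distribˡ-* a c N ⟩
    (a % N * (c % N)) % N   ≡⟨ cong₂ (λ x y → (x * y) % N) a≈b c≈d ⟩
    (b % N * (d % N)) % N   ≡⟨ %-distribˡ-* b d N ⟨
    (b * d) % N             ∎
    where open ≡-Reasoning

  *-congˡ : ∀ a {b c} → b ≈ c → a * b ≈ a * c
  *-congˡ a = *-cong (≈-refl {a})

  *-congʳ : ∀ {a b c} → a ≈ b → a * c ≈ b * c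
  *-congʳ {c = c} a≈b = *-cong a≈b (≈-refl {c})

  ^-cong : ∀ {a b} k → a ≈ b → a ^ k ≈ b ^ k
  ^-cong zero    a≈b = refl
  ^-cong (suc k) a≈b = *-cong a≈b (^-cong k a≈b)

  ∏<-cong≈ : ∀ n {f g} → (∀ j → f j ≈ g j) → ∏< n f ≈ ∏< n g
  ∏<-cong≈ zero    f≈g = refl
  ∏<-cong≈ (suc n) f≈g = *-cong (f≈g n) (∏<-cong≈ n f≈g)

  m+k*N≈m : ∀ a k → a + k * N ≈ a
  m+k*N≈m a k = [m+kn]%n≡m%n a k N

  m%N≈m : ∀ a → a % N ≈ a
  m%N≈m a = m%n%n≡m%n a N

  ≈∧<⇒≡ : ∀ {a b} → a < N → b < N → a ≈ b → a ≡ b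
  ≈∧<⇒≡ a<N b<N a≈b = trans (sym (m<n⇒m%n≡m a<N)) (trans a≈b (m<n⇒m%n≡m b<N))

  ≈1⇒≡1+[m/N]*N : 1 < N → ∀ {a} → a ≈ 1 → a ≡ 1 + (a / N) * N
  ≈1⇒≡1+[m/N]*N 1<N {a} a≈1 = trans (m≡m%n+[m/n]*n a N) (cong (_+ (a / N) * N) (trans a≈1 (m<n⇒m%n≡m 1<N)))

  inverse-unique : ∀ {x y z} → x < N → y < N → x * z ≈ 1 → y * z ≈ 1 → x ≡ y
  inverse-unique {x} {y} {z} x<N y<N xz≈1 yz≈1 = ≈∧<⇒≡ x<N y<N (begin
    x             ≡⟨ *-identityʳ x ⟨
    x * 1         ≈⟨ *-congˡ x (≈-sym yz≈1) ⟩
    x * (y * z)   ≡⟨ x∙yz≈xz∙y x y z ⟩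
    (x * z) * y   ≈⟨ *-congʳ xz≈1 ⟩
    1 * y         ≡⟨ *-identityˡ y ⟩
    y             ∎)
    where open ≈-Reasoning

module UnitPart (q : ℕ) where

  P : ℕ
  P = suc (suc q)

  P∤1 : ¬ P ∣ 1
  P∤1 P∣1 = <⇒≱ (s<s z<s) (∣⇒≤ P∣1)

  ∤⇒>0 : ∀ {m} → ¬ P ∣ m → 0 < m
  ∤⇒>0 {zero}  P∤0 = ⊥-elim (P∤0 (P ∣0))
  ∤⇒>0 {suc m} _   = z<s

  unitAux-∤ : ∀ f n → ¬ P ∣ suc n → unitAux q (suc f) (suc n) ≡ suc n
  unitAux-∤ f n P∤ with suc n % P ≟ 0
  ... | yes ≡0 = ⊥-elim (P∤ (m%n≡0⇒n∣m (suc n) P ≡0))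
  ... | no  _  = refl

  unitAux-∣ : ∀ f n → P ∣ suc n → unitAux q (suc f) (suc n) ≡ unitAux q f (suc n / P)
  unitAux-∣ f n P∣ with suc n % P ≟ 0
  ... | yes _  = refl
  ... | no  ≢0 = ⊥-elim (≢0 (n∣m⇒m%n≡0 (suc n) P P∣))

  unitAux-P^k* : ∀ k f m → k ≤ f → ¬ P ∣ m → unitAux q f (P ^ k * m) ≡ m
  unitAux-P^k* zero f m _ P∤m rewrite *-identityˡ m with f | m
  ... | zero  | _     = refl
  ... | suc _ | zero  = ⊥-elim (P∤m (P ∣0))
  ... | suc f | suc m = unitAux-∤ f m P∤m
  unitAux-P^k* (suc k) (suc f) m (s≤s k≤f) P∤m with P ^ suc k * m in eq
  ... | zero  = ⊥-elim (<⇒≢ (*-mono-< (m^n>0 P (suc k)) (∤⇒>0 P∤m)) (sym eq))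
  ... | suc n = begin
    unitAux q (suc f) (suc n)  ≡⟨ unitAux-∣ f n (divides (P ^ k * m) n≡) ⟩
    unitAux q f (suc n / P)    ≡⟨ cong (unitAux q f) (trans (cong (_/ P) n≡) (m*n/n≡m (P ^ k * m) P)) ⟩
    unitAux q f (P ^ k * m)    ≡⟨ unitAux-P^k* k f m k≤f P∤m ⟩
    m                          ∎
    where open ≡-Reasoning
          n≡ : suc n ≡ P ^ k * m * P
          n≡ = trans (sym eq) (trans (*-assoc P (P ^ k) m) (*-comm P (P ^ k * m)))

  k<P^k : ∀ k → k < P ^ k
  k<P^k zero    = z<s
  k<P^k (suc k) = begin-strict
    suc k          ≤⟨ k<P^k k ⟩
    P ^ k          <⟨ m<m*n (P ^ k) P {{m^n≢0 P k}} (s<s z<s) ⟩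
    P ^ k * P      ≡⟨ *-comm (P ^ k) P ⟩
    P ^ suc k      ∎
    where open ≤-Reasoning

  p-adic-decomposition : ∀ n → 0 < n → ∃₂ λ k m → n ≡ P ^ k * m × ¬ P ∣ m
  p-adic-decomposition = <-rec _ step
    where
    step : ∀ n → (∀ {m} → m < n → 0 < m → ∃₂ λ k m′ → m ≡ P ^ k * m′ × ¬ P ∣ m′) →
           0 < n → ∃₂ λ k m → n ≡ P ^ k * m × ¬ P ∣ m
    step n rec n>0 with P ∣? n
    ... | no  P∤n = 0 , n , sym (*-identityˡ n) , P∤n
    ... | yes (divides zero n≡0) = ⊥-elim (<⇒≢ n>0 (sym n≡0))
    ... | yes (divides n′@(suc _) n≡n′*P) with rec n′<n z<s
      where
      n′<n : n′ < n
      n′<n = subst (n′ <_) (sym n≡n′*P) (m<m*n n′ P (s<s z<s))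
    ... | k , m , n′≡ , P∤m = suc k , m , n≡ , P∤m
      where
      n≡ : n ≡ P ^ suc k * m
      n≡ = begin
        n               ≡⟨ n≡n′*P ⟩
        n′ * P          ≡⟨ cong (_* P) n′≡ ⟩
        P ^ k * m * P   ≡⟨ *-comm (P ^ k * m) P ⟩
        P * (P ^ k * m) ≡⟨ *-assoc P (P ^ k) m ⟨
        P ^ suc k * m   ∎
        where open ≡-Reasoning

  u : ℕ → ℕ
  u = unitPart P

  u-P^k* : ∀ k m → ¬ P ∣ m → u (P ^ k * m) ≡ m
  u-P^k* k m P∤m = unitAux-P^k* k (P ^ k * m) m
    (≤-trans (<⇒≤ (k<P^k k)) (m≤m*n (P ^ k) m {{>-nonZero (∤⇒>0 P∤m)}})) P∤m

  u-∤ : ∀ {m} → ¬ P ∣ m → u m ≡ m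
  u-∤ {m} P∤m = subst (λ n → u n ≡ m) (*-identityˡ m) (u-P^k* 0 m P∤m)

  u-P* : ∀ n → 0 < n → u (P * n) ≡ u n
  u-P* n n>0 with p-adic-decomposition n n>0
  ... | k , m , refl , P∤m = begin
    u (P * (P ^ k * m))  ≡⟨ cong u (*-assoc P (P ^ k) m) ⟨
    u (P ^ suc k * m)    ≡⟨ u-P^k* (suc k) m P∤m ⟩
    m                    ≡⟨ u-P^k* k m P∤m ⟨
    u (P ^ k * m)        ∎
    where open ≡-Reasoning

  u-* : Prime P → ∀ m n → 0 < m → 0 < n → u (m * n) ≡ u m * u n
  u-* P-prime m n m>0 n>0
    with p-adic-decomposition m m>0 | p-adic-decomposition n n>0
  ... | k , a , refl , P∤a | l , b , refl , P∤b = begin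
    u (P ^ k * a * (P ^ l * b))  ≡⟨ cong u (interchange (P ^ k) a (P ^ l) b) ⟩
    u (P ^ k * P ^ l * (a * b))  ≡⟨ cong (λ x → u (x * (a * b))) (^-distribˡ-+-* P k l) ⟨
    u (P ^ (k + l) * (a * b))    ≡⟨ u-P^k* (k + l) (a * b) P∤ab ⟩
    a * b                        ≡⟨ cong₂ _*_ (u-P^k* k a P∤a) (u-P^k* l b P∤b) ⟨
    u (P ^ k * a) * u (P ^ l * b) ∎
    where
    open ≡-Reasoning
    P∤ab : ¬ P ∣ a * b
    P∤ab P∣ab with euclidsLemma a b P-prime P∣ab
    ... | inj₁ P∣a = P∤a P∣a
    ... | inj₂ P∣b = P∤b P∣b

-- The p-free part of factorials

module Factorial (q : ℕ) where
  open UnitPart q public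

  unitFactor : ℕ → ℕ
  unitFactor x = selected (¬? (P ∣? x)) x

  unitFactor-∣ : ∀ {x} → P ∣ x → unitFactor x ≡ 1
  unitFactor-∣ {x} P∣x rewrite dec-true (P ∣? x) P∣x = refl

  unitFactor-∤ : ∀ {x} → ¬ P ∣ x → unitFactor x ≡ x
  unitFactor-∤ {x} P∤x rewrite dec-false (P ∣? x) P∤x = refl

  unitProduct : ℕ → ℕ
  unitProduct n = ∏< n unitFactor

  module _ (P-prime : Prime P) where

    u-! : ∀ n → u (suc n !) ≡ u (suc n) * u (n !)
    u-! n = u-* P-prime (suc n) (n !) z<s (1≤n! n)

    u-[P*M+i]! : ∀ M i → i ≤ suc q → u ((P * M + i) !) ≡ unitProduct (suc (P * M + i)) * u (M !)
    u-[P*M+i]! zero    zero    _ rewrite *-zeroʳ P | unitFactor-∣ (P ∣0) = sym (*-identityʳ (u 1))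
    u-[P*M+i]! (suc M) zero    _ = begin
      u ((P * suc M + 0) !)                    ≡⟨ cong (λ x → u (x !)) P*[1+M]+0≡1+n ⟩
      u (suc n !)                              ≡⟨ u-! n ⟩
      u (suc n) * u (n !)                      ≡⟨ cong₂ _*_ u[1+n]≡u[1+M] (u-[P*M+i]! M (suc q) ≤-refl) ⟩
      u (suc M) * (Π * u (M !))                ≡⟨ x∙yz≈y∙xz (u (suc M)) Π (u (M !)) ⟩
      Π * (u (suc M) * u (M !))                ≡⟨ cong₂ _*_ (sym (*-identityˡ Π)) (sym (u-! M)) ⟩
      1 * Π * u (suc M !)                      ≡⟨ cong (λ x → x * Π * u (suc M !)) (unitFactor-∣ P∣1+n) ⟨
      unitProduct (suc (suc n)) * u (suc M !)  ≡⟨ cong (λ x → unitProduct (suc x) * u (suc M !)) P*[1+M]+0≡1+n ⟨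
      unitProduct (suc (P * suc M + 0)) * u (suc M !) ∎
      where
      open ≡-Reasoning
      n  = P * M + suc q
      Π  = unitProduct (suc n)
      P*[1+M]≡1+n : P * suc M ≡ suc n
      P*[1+M]≡1+n = trans (*-suc P M) (cong suc (+-comm (suc q) (P * M)))
      P*[1+M]+0≡1+n : P * suc M + 0 ≡ suc n
      P*[1+M]+0≡1+n = trans (+-identityʳ _) P*[1+M]≡1+n
      P∣1+n : P ∣ suc n
      P∣1+n = subst (P ∣_) P*[1+M]≡1+n (m∣m*n (suc M))
      u[1+n]≡u[1+M] : u (suc n) ≡ u (suc M)
      u[1+n]≡u[1+M] = trans (cong u (sym P*[1+M]≡1+n)) (u-P* (suc M) z<s)
    u-[P*M+i]! M (suc i) 1+i≤1+q = begin
      u ((P * M + suc i) !)              ≡⟨ cong (λ x → u (x !)) (+-suc (P * M) i) ⟩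
      u (suc n !)                        ≡⟨ u-! n ⟩
      u (suc n) * u (n !)                ≡⟨ cong₂ _*_ (u-∤ P∤1+n) (u-[P*M+i]! M i (<⇒≤ 1+i≤1+q)) ⟩
      suc n * (Π * u (M !))              ≡⟨ *-assoc (suc n) Π (u (M !)) ⟨
      suc n * Π * u (M !)                ≡⟨ cong (λ x → x * Π * u (M !)) (unitFactor-∤ P∤1+n) ⟨
      unitProduct (suc (suc n)) * u (M !) ≡⟨ cong (λ x → unitProduct (suc x) * u (M !)) (+-suc (P * M) i) ⟨
      unitProduct (suc (P * M + suc i)) * u (M !) ∎
      where
      open ≡-Reasoning
      n = P * M + i
      Π = unitProduct (suc n)
      P∤1+n : ¬ P ∣ suc n
      P∤1+n P∣1+n = <⇒≱ (s<s (s<s (≤-pred 1+i≤1+q)))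
        (∣⇒≤ (∣m+n∣m⇒∣n (subst (P ∣_) (sym (+-suc (P * M) i)) P∣1+n) (m∣m*n M)))

    u-[P*M]! : ∀ M → u ((P * M) !) ≡ unitProduct (P * M) * u (M !)
    u-[P*M]! M = begin
      u ((P * M) !)                                  ≡⟨ cong (λ x → u (x !)) (+-identityʳ (P * M)) ⟨
      u ((P * M + 0) !)                              ≡⟨ u-[P*M+i]! M 0 z≤n ⟩
      unitProduct (suc (P * M + 0)) * u (M !)        ≡⟨ cong (λ x → unitProduct (suc x) * u (M !)) (+-identityʳ (P * M)) ⟩
      unitFactor (P * M) * unitProduct (P * M) * u (M !)
        ≡⟨ cong (λ x → x * unitProduct (P * M) * u (M !)) (unitFactor-∣ (m∣m*n M)) ⟩
      1 * unitProduct (P * M) * u (M !)              ≡⟨ cong (_* u (M !)) (*-identityˡ (unitProduct (P * M))) ⟩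
      unitProduct (P * M) * u (M !)                  ∎
      where open ≡-Reasoning

  module Periodicity (N : ℕ) .{{_ : NonZero N}} (P∣N : P ∣ N) where
    open Modulo N

    unitFactor-periodic : ∀ t j → unitFactor (t * N + j) ≈ unitFactor j
    unitFactor-periodic t j = by-cases (P ∣? j)
      where
      by-cases : Dec (P ∣ j) → unitFactor (t * N + j) ≈ unitFactor j
      by-cases (yes P∣j) =
        ≈-reflexive (trans (unitFactor-∣ (∣m∣n⇒∣m+n (∣n⇒∣m*n t P∣N) P∣j)) (sym (unitFactor-∣ P∣j)))
      by-cases (no  P∤j) = begin
        unitFactor (t * N + j)  ≡⟨ unitFactor-∤ P∤t*N+j ⟩
        t * N + j               ≡⟨ +-comm (t * N) j ⟩
        j + t * N               ≈⟨ m+k*N≈m j t ⟩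
        j                       ≡⟨ unitFactor-∤ P∤j ⟨
        unitFactor j            ∎
        where
        open ≈-Reasoning
        P∤t*N+j : ¬ P ∣ t * N + j
        P∤t*N+j P∣ = P∤j (∣m+n∣m⇒∣n P∣ (∣n⇒∣m*n t P∣N))

    unitProduct-shift : ∀ t n → unitProduct (t * N + n) ≈ unitProduct n * unitProduct (t * N)
    unitProduct-shift t n = begin
      unitProduct (t * N + n)                                 ≡⟨ ∏<-+ (t * N) n unitFactor ⟩
      ∏< n (λ j → unitFactor (t * N + j)) * unitProduct (t * N) ≈⟨ *-congʳ (∏<-cong≈ n (unitFactor-periodic t)) ⟩
      unitProduct n * unitProduct (t * N)                     ∎
      where open ≈-Reasoning

    unitProduct-*N : ∀ a → unitProduct (a * N) ≈ unitProduct N ^ a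
    unitProduct-*N zero    = ≈-refl {1}
    unitProduct-*N (suc a) = begin
      unitProduct (N + a * N)                ≡⟨ cong unitProduct (+-comm N (a * N)) ⟩
      unitProduct (a * N + N)                ≈⟨ unitProduct-shift a N ⟩
      unitProduct N * unitProduct (a * N)    ≈⟨ *-congˡ (unitProduct N) (unitProduct-*N a) ⟩
      unitProduct N * unitProduct N ^ a      ∎
      where open ≈-Reasoning

-- Products over decidable subsets and pairing with inverses

∏∈ : {S : Pred ℕ 0ℓ} → Decidable S → ℕ → ℕ
∏∈ S? n = ∏< n (λ x → selected (S? x) x)

_─_ : Pred ℕ 0ℓ → ℕ → Pred ℕ 0ℓ
(S ─ a) x = S x × x ≢ a

_─?_ : {S : Pred ℕ 0ℓ} → Decidable S → ∀ a → Decidable (S ─ a)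
(S? ─? a) x = S? x ×-dec ¬? (x ≟ a)

module _ {S : Pred ℕ 0ℓ} (S? : Decidable S) where

  selected-∈ : ∀ {x} → S x → selected (S? x) x ≡ x
  selected-∈ {x} x∈S with S? x
  ... | yes _   = refl
  ... | no  x∉S = ⊥-elim (x∉S x∈S)

  ∏∈-∅ : ∀ n → (∀ {x} → x < n → ¬ S x) → ∏∈ S? n ≡ 1
  ∏∈-∅ zero    _   = refl
  ∏∈-∅ (suc n) ∅<n with S? n
  ... | yes n∈S = ⊥-elim (∅<n ≤-refl n∈S)
  ... | no  _   = trans (*-identityˡ _) (∏∈-∅ n (∅<n ∘ m<n⇒m<1+n))

  selected-─ : ∀ {a x} → x ≢ a → selected ((S? ─? a) x) x ≡ selected (S? x) x
  selected-─ {a} {x} x≢a with S? x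
  ... | yes _ rewrite dec-false (x ≟ a) x≢a = refl
  ... | no  _ = refl

  selected-─-self : ∀ a → selected ((S? ─? a) a) a ≡ 1
  selected-─-self a with S? a
  ... | yes _ rewrite dec-true (a ≟ a) refl = refl
  ... | no  _ = refl

  ∏∈-─ : ∀ {a} n → S a → a < n → ∏∈ S? n ≡ a * ∏∈ (S? ─? a) n
  ∏∈-─ {a} (suc m) a∈S a<1+m with m ≟ a
  ... | yes refl = begin
    selected (S? m) m * ∏∈ S? m
      ≡⟨ cong₂ _*_ (selected-∈ a∈S) (∏<-cong m (λ {j} j<m → sym (selected-─ {m} {j} (<⇒≢ j<m)))) ⟩
    m * ∏∈ (S? ─? m) m                             ≡⟨ cong (m *_) (*-identityˡ _) ⟨
    m * (1 * ∏∈ (S? ─? m) m)                       ≡⟨ cong (λ x → m * (x * ∏∈ (S? ─? m) m)) (selected-─-self m) ⟨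
    m * (selected ((S? ─? m) m) m * ∏∈ (S? ─? m) m) ∎
    where open ≡-Reasoning
  ... | no  m≢a = begin
    selected (S? m) m * ∏∈ S? m
      ≡⟨ cong₂ _*_ (sym (selected-─ {a} {m} m≢a)) (∏∈-─ m a∈S (≤∧≢⇒< (≤-pred a<1+m) (m≢a ∘ sym))) ⟩
    selected ((S? ─? a) m) m * (a * ∏∈ (S? ─? a) m) ≡⟨ x∙yz≈y∙xz (selected ((S? ─? a) m) m) a (∏∈ (S? ─? a) m) ⟩
    a * (selected ((S? ─? a) m) m * ∏∈ (S? ─? a) m) ∎
    where open ≡-Reasoning

_─*_ : Pred ℕ 0ℓ → List ℕ → Pred ℕ 0ℓ
S ─* []       = S
S ─* (r ∷ rs) = (S ─* rs) ─ r

_─*?_ : {S : Pred ℕ 0ℓ} → Decidable S → ∀ rs → Decidable (S ─* rs)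
S? ─*? []       = S?
S? ─*? (r ∷ rs) = (S? ─*? rs) ─? r

module _ {S : Pred ℕ 0ℓ} where

  ─*⁺ : ∀ rs {x} → S x → x ∉ rs → (S ─* rs) x
  ─*⁺ []       x∈S _    = x∈S
  ─*⁺ (r ∷ rs) x∈S x∉rs = ─*⁺ rs x∈S (x∉rs ∘ there) , x∉rs ∘ here

  ─*⁻ : ∀ rs {x} → (S ─* rs) x → S x × x ∉ rs
  ─*⁻ []       x∈S = x∈S , λ ()
  ─*⁻ (r ∷ rs) (x∈S─*rs , x≢r) with ─*⁻ rs x∈S─*rs
  ... | x∈S , x∉rs = x∈S , λ { (here x≡r) → x≢r x≡r ; (there x∈rs) → x∉rs x∈rs }

  ∏∈-─* : (S? : Decidable S) → ∀ n {rs} → Unique rs → All S rs → All (_< n) rs →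
          ∏∈ S? n ≡ product rs * ∏∈ (S? ─*? rs) n
  ∏∈-─* S? n {[]}     _               _            _          = sym (+-identityʳ _)
  ∏∈-─* S? n {r ∷ rs} (r∉rs ∷ rs-uniq) (r∈S ∷ rs⊆S) (r<n ∷ rs<n) = begin
    ∏∈ S? n                                    ≡⟨ ∏∈-─* S? n rs-uniq rs⊆S rs<n ⟩
    product rs * ∏∈ (S? ─*? rs) n
      ≡⟨ cong (product rs *_) (∏∈-─ (S? ─*? rs) n (─*⁺ rs r∈S r∉rs′) r<n) ⟩
    product rs * (r * ∏∈ (S? ─*? (r ∷ rs)) n)   ≡⟨ x∙yz≈yx∙z (product rs) r _ ⟩
    r * product rs * ∏∈ (S? ─*? (r ∷ rs)) n     ∎
    where
    open ≡-Reasoning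
    r∉rs′ : r ∉ rs
    r∉rs′ r∈rs = lookup r∉rs r∈rs refl

module Inverses (N : ℕ) .{{_ : NonZero N}} where
  open Modulo N

  Paired : Pred ℕ 0ℓ → Set
  Paired S = ∀ {x} → S x → ∃[ y ] (S y × y ≢ x × x * y ≈ 1)

  ∏∈-paired≈1 : ∀ b {S} (S? : Decidable S) → b ≤ N → (∀ {x} → S x → x < b) → Paired S → ∏∈ S? N ≈ 1
  ∏∈-paired≈1 zero    S? _   S<0 _ = ≈-reflexive (∏∈-∅ S? N (λ _ x∈S → n≮0 (S<0 x∈S)))
  ∏∈-paired≈1 (suc m) {S} S? 1+m≤N S<1+m paired with S? m
  ... | no  m∉S = ∏∈-paired≈1 m S? (≤-trans (n≤1+n m) 1+m≤N) S<m paired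
    where
    S<m : ∀ {x} → S x → x < m
    S<m {x} x∈S = ≤∧≢⇒< (≤-pred (S<1+m x∈S)) (λ { refl → m∉S x∈S })
  ... | yes m∈S with paired m∈S
  ... | y , y∈S , y≢m , my≈1 = begin
    ∏∈ S? N                         ≡⟨ ∏∈-─ S? N m∈S 1+m≤N ⟩
    m * ∏∈ (S? ─? m) N              ≡⟨ cong (m *_) (∏∈-─ (S? ─? m) N (y∈S , y≢m) y<N) ⟩
    m * (y * ∏∈ S′? N)              ≡⟨ *-assoc m y _ ⟨
    m * y * ∏∈ S′? N                ≈⟨ *-cong my≈1 (∏∈-paired≈1 m S′? (<⇒≤ 1+m≤N) S′<m paired′) ⟩
    1 * 1                           ∎
    where
    open ≈-Reasoning
    S′? = (S? ─? m) ─? y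
    y<m : y < m
    y<m = ≤∧≢⇒< (≤-pred (S<1+m y∈S)) y≢m
    y<N : y < N
    y<N = <-trans y<m 1+m≤N
    S′<m : ∀ {x} → ((S ─ m) ─ y) x → x < m
    S′<m ((x∈S , x≢m) , _) = ≤∧≢⇒< (≤-pred (S<1+m x∈S)) x≢m
    paired′ : Paired ((S ─ m) ─ y)
    paired′ {x} x∈S′@((x∈S , x≢m) , x≢y) with paired x∈S
    ... | z , z∈S , z≢x , xz≈1 = z , ((z∈S , z≢m) , z≢y) , z≢x , xz≈1
      where
      x<N : x < N
      x<N = <-trans (S′<m x∈S′) 1+m≤N
      z≢m : z ≢ m
      z≢m refl = x≢y (inverse-unique x<N y<N xz≈1 (trans (cong (_% N) (*-comm y m)) my≈1))
      z≢y : z ≢ y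
      z≢y refl = x≢m (inverse-unique x<N 1+m≤N xz≈1 my≈1)

  ∏∈≈product-of-self-inverse : ∀ {S} (S? : Decidable S) → (∀ {x} → S x → x < N) →
    (∀ {x} → S x → ∃[ y ] (S y × x * y ≈ 1)) →
    ∀ rs → Unique rs → All S rs → All (λ r → r * r ≈ 1) rs → (∀ {x} → S x → x * x ≈ 1 → x ∈ rs) →
    ∏∈ S? N ≈ product rs
  ∏∈≈product-of-self-inverse {S} S? S<N inverse rs rs-uniq rs⊆S rs-roots roots⊆rs = begin
    ∏∈ S? N                          ≡⟨ ∏∈-─* S? N rs-uniq rs⊆S (All.map S<N rs⊆S) ⟩
    product rs * ∏∈ (S? ─*? rs) N     ≈⟨ *-congˡ (product rs) (∏∈-paired≈1 N (S? ─*? rs) ≤-refl (S<N ∘ proj₁ ∘ ─*⁻ rs) paired) ⟩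
    product rs * 1                    ≡⟨ *-identityʳ (product rs) ⟩
    product rs                        ∎
    where
    open ≈-Reasoning
    paired : Paired (S ─* rs)
    paired {x} x∈S─*rs with ─*⁻ rs x∈S─*rs
    ... | x∈S , x∉rs with inverse x∈S
    ... | y , y∈S , xy≈1 = y , ─*⁺ rs y∈S y∉rs , y≢x , xy≈1
      where
      y≢x : y ≢ x
      y≢x refl = x∉rs (roots⊆rs x∈S xy≈1)
      y∉rs : y ∉ rs
      y∉rs y∈rs = x∉rs (subst (_∈ rs) (sym (inverse-unique (S<N x∈S) (S<N y∈S) xy≈1 (lookup rs-roots y∈rs))) y∈rs)

module PrimePower (q : ℕ) (P-prime : Prime (suc (suc q))) (e : ℕ) where
  open Factorial q public

  N : ℕ
  N = P ^ suc e

  instance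
    N-nonZero : NonZero N
    N-nonZero = m^n≢0 P (suc e)

  open Modulo N
  open Inverses N

  P∣N : P ∣ N
  P∣N = m∣m*n (P ^ e)

  1<N : 1 < N
  1<N = ≤-trans (s<s (s<s z≤n)) (∣⇒≤ P∣N)

  coprime-P^ : ∀ k {x} → ¬ P ∣ x → Coprime (P ^ k) x
  coprime-P^ zero    _   (d∣1 , _)     = ∣1⇒≡1 d∣1
  coprime-P^ (suc k) P∤x {d} (d∣P*P^k , d∣x) =
    coprime-P^ k P∤x (coprime-divisor d⊥P d∣P*P^k , d∣x)
    where
    d⊥P : Coprime d P
    d⊥P {g} (g∣d , g∣P) with prime⇒irreducible P-prime g∣P
    ... | inj₁ g≡1 = g≡1
    ... | inj₂ refl = ⊥-elim (P∤x (∣-trans g∣d d∣x))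

  coprime-N : ∀ {x} → ¬ P ∣ x → Coprime x N
  coprime-N P∤x = Coprime.sym (coprime-P^ (suc e) P∤x)

  inverse-exists : ∀ {x} → ¬ P ∣ x → ∃[ y ] (x * y ≈ 1)
  inverse-exists {x} P∤x with coprime-Bézout (coprime-N P∤x)
  ... | Bézout.+- a b 1+bN≡ax = a , (begin
    x * a       ≡⟨ *-comm x a ⟩
    a * x       ≡⟨ 1+bN≡ax ⟨
    1 + b * N   ≈⟨ m+k*N≈m 1 b ⟩
    1           ∎)
    where open ≈-Reasoning
  -- Here a * x ≡ −1, so a * (N − 1) inverts x.
  ... | Bézout.-+ a b 1+ax≡bN = a * c , (begin
    x * (a * c)                 ≈⟨ m+k*N≈m (x * (a * c)) 1 ⟨
    x * (a * c) + 1 * N         ≡⟨ cong (λ n → x * (a * c) + 1 * n) N≡1+c ⟩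
    x * (a * c) + 1 * suc c     ≡⟨ identity x a c ⟩
    c * (1 + a * x) + 1         ≡⟨ cong (λ n → c * n + 1) 1+ax≡bN ⟩
    c * (b * N) + 1             ≡⟨ trans (cong suc (*-assoc c b N)) (+-comm 1 (c * (b * N))) ⟨
    1 + c * b * N               ≈⟨ m+k*N≈m 1 (c * b) ⟩
    1                           ∎)
    where
    open ≈-Reasoning
    c = pred N
    N≡1+c : N ≡ suc c
    N≡1+c = sym (suc-pred N)
    identity : ∀ x a c → x * (a * c) + 1 * suc c ≡ c * (1 + a * x) + 1
    identity = solve-∀

  inverse-∤ : ∀ {x y} → x * y ≈ 1 → ¬ P ∣ y
  inverse-∤ {x} {y} xy≈1 P∣y =
    P∤1 (∣m+n∣m⇒∣n (subst (P ∣_) (trans (≈1⇒≡1+[m/N]*N 1<N xy≈1) (+-comm 1 _)) (∣n⇒∣m*n x P∣y))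
                   (∣n⇒∣m*n (x * y / N) P∣N))

  Unit : Pred ℕ 0ℓ
  Unit x = x < N × ¬ P ∣ x

  Unit? : Decidable Unit
  Unit? x = x <? N ×-dec ¬? (P ∣? x)

  unit-inverse : ∀ {x} → Unit x → ∃[ y ] (Unit y × x * y ≈ 1)
  unit-inverse {x} (_ , P∤x) with inverse-exists P∤x
  ... | y , xy≈1 = y % N , (m%n<n y N , inverse-∤ {x} xy%N≈1) , xy%N≈1
    where
    xy%N≈1 : x * (y % N) ≈ 1
    xy%N≈1 = ≈-trans (*-congˡ x (m%N≈m y)) xy≈1

  ∏∈Unit≡unitProduct : ∏∈ Unit? N ≡ unitProduct N
  ∏∈Unit≡unitProduct = ∏<-cong N selected≡unitFactor
    where
    selected≡unitFactor : ∀ {j} → j < N → selected (Unit? j) j ≡ unitFactor j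
    selected≡unitFactor {j} j<N rewrite dec-true (j <? N) j<N = refl

  unitProduct≈product-of-roots : ∀ rs → Unique rs → All Unit rs → All (λ r → r * r ≈ 1) rs →
    (∀ {x} → Unit x → x * x ≈ 1 → x ∈ rs) → unitProduct N ≈ product rs
  unitProduct≈product-of-roots rs rs-uniq rs⊆Unit rs-roots roots⊆rs = begin
    unitProduct N  ≡⟨ ∏∈Unit≡unitProduct ⟨
    ∏∈ Unit? N     ≈⟨ ∏∈≈product-of-self-inverse Unit? proj₁ unit-inverse rs rs-uniq rs⊆Unit rs-roots roots⊆rs ⟩
    product rs     ∎
    where open ≈-Reasoning

  u-[α*N]! : ∀ α → u ((α * N) !) ≈ unitProduct N ^ α * u ((α * P ^ e) !)
  u-[α*N]! α = begin
    u ((α * N) !)                        ≡⟨ cong (λ x → u (x !)) α*N≡P*M ⟩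
    u ((P * M) !)                        ≡⟨ u-[P*M]! P-prime M ⟩
    unitProduct (P * M) * u (M !)        ≡⟨ cong (λ x → unitProduct x * u (M !)) α*N≡P*M ⟨
    unitProduct (α * N) * u (M !)        ≈⟨ *-congʳ (unitProduct-*N α) ⟩
    unitProduct N ^ α * u (M !)          ∎
    where
    open ≈-Reasoning
    open Periodicity N P∣N
    M = α * P ^ e
    α*N≡P*M : α * N ≡ P * M
    α*N≡P*M = x∙yz≈y∙xz α P (P ^ e)

-- Square roots of 1 and the theorem of Gauss

2∤1+t*2 : ∀ t → ¬ 2 ∣ 1 + t * 2
2∤1+t*2 t 2∣ = UnitPart.P∤1 0 (∣m+n∣m⇒∣n (subst (2 ∣_) (+-comm 1 (t * 2)) 2∣) (n∣m*n t))

odd⇒≡1+t*2 : ∀ {x} → ¬ 2 ∣ x → ∃[ t ] x ≡ 1 + t * 2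
odd⇒≡1+t*2 {zero}        2∤0   = ⊥-elim (2∤0 (2 ∣0))
odd⇒≡1+t*2 {suc zero}    _     = 0 , refl
odd⇒≡1+t*2 {suc (suc x)} 2∤2+x with odd⇒≡1+t*2 (2∤2+x ∘ ∣m∣n⇒∣m+n (∣-refl {2}))
... | t , refl = suc t , refl

∣∧<⇒≡0 : ∀ {n m} → n ∣ m → m < n → m ≡ 0
∣∧<⇒≡0 {m = zero}  _   _   = refl
∣∧<⇒≡0 {m = suc m} n∣m m<n = ⊥-elim (<⇒≱ m<n (∣⇒≤ n∣m))

∣∧≤⇒≡0⊎≡ : ∀ {n m} → n ∣ m → m ≤ n → m ≡ 0 ⊎ m ≡ n
∣∧≤⇒≡0⊎≡ {m = zero}  _   _   = inj₁ refl
∣∧≤⇒≡0⊎≡ {m = suc m} n∣m m≤n = inj₂ (≤-antisym m≤n (∣⇒≤ n∣m))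

module OddPrimePower (q : ℕ) (P-prime : Prime (suc (suc (suc q)))) (e : ℕ) where
  open PrimePower (suc q) P-prime e public
  open Modulo N

  -- N − 1 = suc d, the only square root of 1 besides 1.
  d : ℕ
  d = N ∸ 2

  N≡2+d : N ≡ 2 + d
  N≡2+d = sym (m+[n∸m]≡n (≤-trans (s≤s (s≤s z≤n)) (∣⇒≤ P∣N)))

  P∤2 : ¬ P ∣ 2
  P∤2 P∣2 = <⇒≱ (s<s (s<s z<s)) (∣⇒≤ P∣2)

  roots : List ℕ
  roots = 1 ∷ suc d ∷ []

  roots-unique : Unique roots
  roots-unique = AllPairs.map <⇒≢ (Linked⇒AllPairs <-trans (1<1+d ∷ [-]))
    where
    1<1+d : 1 < suc d
    1<1+d = s≤s (≤-pred (≤-pred (subst (3 ≤_) N≡2+d (≤-trans (s≤s (s≤s (s≤s z≤n))) (∣⇒≤ P∣N)))))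

  roots-units : All Unit roots
  roots-units = (1<N , P∤1) ∷ (1+d<N , P∤1+d) ∷ []
    where
    1+d<N : suc d < N
    1+d<N = subst (suc d <_) (sym N≡2+d) ≤-refl
    P∤1+d : ¬ P ∣ suc d
    P∤1+d P∣1+d = P∤1 (∣m+n∣m⇒∣n (subst (P ∣_) (trans N≡2+d (+-comm 1 (suc d))) P∣N) P∣1+d)

  roots-square : All (λ r → r * r ≈ 1) roots
  roots-square = ≈-refl {1} ∷ [1+d]²≈1 ∷ []
    where
    [1+d]²≈1 : suc d * suc d ≈ 1
    [1+d]²≈1 = begin
      suc d * suc d        ≡⟨ square d ⟩
      1 + d * (2 + d)      ≡⟨ cong (λ x → 1 + d * x) N≡2+d ⟨
      1 + d * N            ≈⟨ m+k*N≈m 1 d ⟩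
      1                    ∎
      where
      open ≈-Reasoning
      square : ∀ d → suc d * suc d ≡ 1 + d * (2 + d)
      square = solve-∀

  ≈1⇒N∣w[2+w] : ∀ {w} → suc w * suc w ≈ 1 → N ∣ w * (2 + w)
  ≈1⇒N∣w[2+w] {w} [1+w]²≈1 = divides ((suc w * suc w) / N) (suc-injective (trans (square w) (≈1⇒≡1+[m/N]*N 1<N [1+w]²≈1)))
    where
    square : ∀ w → suc (w * (2 + w)) ≡ suc w * suc w
    square = solve-∀

  roots-complete : ∀ {x} → Unit x → x * x ≈ 1 → x ∈ roots
  roots-complete {zero}  (_ , P∤0) _ = ⊥-elim (P∤0 (P ∣0))
  roots-complete {suc w} (1+w<N , P∤1+w) x²≈1 with P ∣? w
  ... | yes P∣w = here (cong suc (∣∧<⇒≡0 N∣w (<-trans (n<1+n w) 1+w<N)))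
    where
    P∤2+w : ¬ P ∣ 2 + w
    P∤2+w P∣2+w = P∤2 (∣m+n∣m⇒∣n (subst (P ∣_) (+-comm 2 w) P∣2+w) P∣w)
    N∣w : N ∣ w
    N∣w = coprime-divisor (coprime-P^ (suc e) P∤2+w) (subst (N ∣_) (*-comm w (2 + w)) (≈1⇒N∣w[2+w] {w} x²≈1))
  ... | no  P∤w with ∣∧≤⇒≡0⊎≡ (coprime-divisor (coprime-P^ (suc e) P∤w) (≈1⇒N∣w[2+w] {w} x²≈1)) 1+w<N
  ...   | inj₁ ()
  ...   | inj₂ 2+w≡N = there (here (suc-injective (trans 2+w≡N N≡2+d)))

  unitProduct≈N-1 : unitProduct N ≈ suc d
  unitProduct≈N-1 = ≈-trans (unitProduct≈product-of-roots roots roots-unique roots-units roots-square roots-complete)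
                            (≈-reflexive (trans (*-identityˡ _) (*-identityʳ (suc d))))

  2∤P : ¬ 2 ∣ P
  2∤P 2∣P with prime⇒irreducible P-prime 2∣P
  ... | inj₁ ()
  ... | inj₂ ()

  -1^P≡-1 : -1ℤ ^ℤ P ≡ -1ℤ
  -1^P≡-1 with odd⇒≡1+t*2 2∤P
  ... | t , P≡1+t*2 = trans (cong (-1ℤ ^ℤ_) P≡1+t*2) (-1^[1+t*2]≡-1 t)

  wilson-odd : + N ∣ₛ + unitProduct N -ℤ -1ℤ ^ℤ P
  wilson-odd = ∣m-n∣n-o⇒∣m-o {+ N} {+ unitProduct N} {+ suc d} { -1ℤ ^ℤ P}
    (%≡%⇒∣- N (unitProduct N) (suc d) unitProduct≈N-1) (divides 1ℤ 1+d+1≡N)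
    where
    open ≡-Reasoning
    1+d+1≡N : + suc d -ℤ -1ℤ ^ℤ P ≡ 1ℤ *ℤ + N
    1+d+1≡N = begin
      + suc d -ℤ -1ℤ ^ℤ P    ≡⟨ cong (+ suc d -ℤ_) -1^P≡-1 ⟩
      + suc d -ℤ -1ℤ         ≡⟨ ℤ.pos-+ (suc d) 1 ⟨
      + (suc d + 1)          ≡⟨ cong +_ (trans (+-comm (suc d) 1) (sym N≡2+d)) ⟩
      + N                    ≡⟨ ℤ.*-identityˡ (+ N) ⟨
      1ℤ *ℤ + N              ∎

∣∧≤2*⇒≡0⊎≡⊎≡2* : ∀ {n m} .{{_ : NonZero n}} → n ∣ m → m ≤ 2 * n → m ≡ 0 ⊎ m ≡ n ⊎ m ≡ 2 * n
∣∧≤2*⇒≡0⊎≡⊎≡2* {n} (divides d refl) dn≤2n with *-cancelʳ-≤ d 2 n dn≤2n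
... | z≤n             = inj₁ refl
... | s≤s z≤n         = inj₂ (inj₁ (*-identityˡ n))
... | s≤s (s≤s z≤n)   = inj₂ (inj₂ refl)

module PowerOfTwo (k : ℕ) where
  open PrimePower 0 prime[2] (suc (suc k)) public
  open Modulo N

  H : ℕ
  H = 2 ^ suc k

  instance
    H-nonZero : NonZero H
    H-nonZero = m^n≢0 2 (suc k)

  h : ℕ
  h = pred H

  H≡1+h : H ≡ suc h
  H≡1+h = sym (suc-pred H)

  QH*4≡Q*N : ∀ Q H → Q * H * 4 ≡ Q * (2 * (2 * H))
  QH*4≡Q*N = solve-∀

  [1+t*2]²≡1+t[1+t]*4 : ∀ t → (1 + t * 2) * (1 + t * 2) ≡ 1 + t * (1 + t) * 4
  [1+t*2]²≡1+t[1+t]*4 = solve-∀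

  ∣⇒[1+t*2]²≈1 : ∀ t → H ∣ t * (1 + t) → (1 + t * 2) * (1 + t * 2) ≈ 1
  ∣⇒[1+t*2]²≈1 t (divides Q t[1+t]≡QH) = begin
    (1 + t * 2) * (1 + t * 2)   ≡⟨ [1+t*2]²≡1+t[1+t]*4 t ⟩
    1 + t * (1 + t) * 4         ≡⟨ cong (λ x → 1 + x * 4) t[1+t]≡QH ⟩
    1 + Q * H * 4               ≡⟨ cong suc (QH*4≡Q*N Q H) ⟩
    1 + Q * N                   ≈⟨ m+k*N≈m 1 Q ⟩
    1                           ∎
    where open ≈-Reasoning

  [1+t*2]²≈1⇒∣ : ∀ t → (1 + t * 2) * (1 + t * 2) ≈ 1 → H ∣ t * (1 + t)
  [1+t*2]²≈1⇒∣ t ≈1 = divides Q (*-cancelʳ-≡ _ _ 4 (suc-injective (begin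
    1 + t * (1 + t) * 4          ≡⟨ [1+t*2]²≡1+t[1+t]*4 t ⟨
    (1 + t * 2) * (1 + t * 2)    ≡⟨ ≈1⇒≡1+[m/N]*N 1<N ≈1 ⟩
    1 + Q * N                    ≡⟨ cong suc (QH*4≡Q*N Q H) ⟨
    1 + Q * H * 4                ∎)))
    where
    open ≡-Reasoning
    Q = (1 + t * 2) * (1 + t * 2) / N

  1+t*2<N⇒t<2H : ∀ {t} → 1 + t * 2 < N → t < 2 * H
  1+t*2<N⇒t<2H {t} 1+t*2<N = *-cancelʳ-< 2 t (2 * H) (subst (t * 2 <_) (*-comm 2 (2 * H)) (<-trans (n<1+n (t * 2)) 1+t*2<N))

  t<2H⇒1+t*2<N : ∀ {t} → t < 2 * H → 1 + t * 2 < N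
  t<2H⇒1+t*2<N {t} t<2H = subst (suc (t * 2) <_) (*-comm (2 * H) 2) (*-monoˡ-≤ 2 t<2H)

  0<h : 0 < h
  0<h = ≤-pred (subst (1 <_) H≡1+h (*-monoʳ-≤ 2 (m^n>0 2 k)))

  h<H : h < H
  h<H = subst (h <_) (sym H≡1+h) ≤-refl

  H+h<2H : H + h < 2 * H
  H+h<2H = +-monoʳ-< H (subst (h <_) (sym (+-identityʳ H)) h<H)

  -- 1, 2H − 1, 2H + 1 and 4H − 1, each written as 1 + t * 2.
  roots : List ℕ
  roots = 1 ∷ 1 + h * 2 ∷ 1 + H * 2 ∷ 1 + (H + h) * 2 ∷ []

  roots-unique : Unique roots
  roots-unique = AllPairs.map <⇒≢ (Linked⇒AllPairs <-trans (odd-< 0<h ∷ odd-< h<H ∷ odd-< (m<m+n H 0<h) ∷ [-]))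
    where
    odd-< : ∀ {t t′} → t < t′ → 1 + t * 2 < 1 + t′ * 2
    odd-< t<t′ = +-monoʳ-< 1 (*-monoˡ-< 2 t<t′)

  H<2H : H < 2 * H
  H<2H = m<m+n H (subst (0 <_) (sym (+-identityʳ H)) (<-trans 0<h h<H))

  roots-units : All Unit roots
  roots-units = unit (<-trans (<-trans 0<h h<H) H<2H) ∷ unit (<-trans h<H H<2H) ∷ unit H<2H ∷ unit H+h<2H ∷ []
    where
    unit : ∀ {t} → t < 2 * H → Unit (1 + t * 2)
    unit {t} t<2H = t<2H⇒1+t*2<N t<2H , 2∤1+t*2 t

  1+[H+h]≡2H : 1 + (H + h) ≡ 2 * H
  1+[H+h]≡2H = begin
    1 + (H + h)   ≡⟨ +-suc H h ⟨
    H + suc h     ≡⟨ cong (_+_ H) H≡1+h ⟨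
    H + H         ≡⟨ cong (_+_ H) (+-identityʳ H) ⟨
    2 * H         ∎
    where open ≡-Reasoning

  roots-square : All (λ r → r * r ≈ 1) roots
  roots-square = ∣⇒[1+t*2]²≈1 0 (H ∣0)
               ∷ ∣⇒[1+t*2]²≈1 h (subst (λ n → H ∣ h * n) H≡1+h (n∣m*n h))
               ∷ ∣⇒[1+t*2]²≈1 H (m∣m*n (1 + H))
               ∷ ∣⇒[1+t*2]²≈1 (H + h) (subst (λ n → H ∣ (H + h) * n) (sym 1+[H+h]≡2H) (∣n⇒∣m*n (H + h) (n∣m*n 2)))
               ∷ []

  1+t*2∈roots : ∀ t → t < 2 * H → H ∣ t * (1 + t) → 1 + t * 2 ∈ roots
  1+t*2∈roots t t<2H H∣t[1+t] with 2 ∣? t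
  ... | yes 2∣t with ∣∧≤2*⇒≡0⊎≡⊎≡2* H∣t (<⇒≤ t<2H)
    where
    2∤1+t : ¬ 2 ∣ 1 + t
    2∤1+t 2∣1+t = 2∤1+t*2 0 (∣m+n∣m⇒∣n (subst (2 ∣_) (+-comm 1 t) 2∣1+t) 2∣t)
    H∣t : H ∣ t
    H∣t = coprime-divisor (coprime-P^ (suc k) 2∤1+t) (subst (H ∣_) (*-comm t (1 + t)) H∣t[1+t])
  ...   | inj₁ refl        = here refl
  ...   | inj₂ (inj₁ refl) = there (there (here refl))
  ...   | inj₂ (inj₂ refl) = ⊥-elim (<-irrefl refl t<2H)
  1+t*2∈roots t t<2H H∣t[1+t] | no 2∤t
    with ∣∧≤2*⇒≡0⊎≡⊎≡2* (coprime-divisor (coprime-P^ (suc k) 2∤t) H∣t[1+t]) t<2H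
  ...   | inj₁ ()
  ...   | inj₂ (inj₁ 1+t≡H)  = there (here (cong (λ t → 1 + t * 2) (suc-injective (trans 1+t≡H H≡1+h))))
  ...   | inj₂ (inj₂ 1+t≡2H) = there (there (there (here (cong (λ t → 1 + t * 2) (suc-injective (trans 1+t≡2H (sym 1+[H+h]≡2H)))))))

  roots-complete : ∀ {x} → Unit x → x * x ≈ 1 → x ∈ roots
  roots-complete (x<N , 2∤x) x²≈1 with odd⇒≡1+t*2 2∤x
  ... | t , refl = 1+t*2∈roots t (1+t*2<N⇒t<2H x<N) ([1+t*2]²≈1⇒∣ t x²≈1)

  product-roots≈1 : product roots ≈ 1
  product-roots≈1 = begin
    product roots                          ≡⟨ identity H h H≡1+h ⟩
    1 + (4 * h * h + 7 * h + 2) * N        ≈⟨ m+k*N≈m 1 (4 * h * h + 7 * h + 2) ⟩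
    1                                      ∎
    where
    open ≈-Reasoning
    -- H is kept a variable so that matching on H ≡ suc h leaves a ring identity.
    identity : ∀ H h → H ≡ suc h →
      1 * ((1 + h * 2) * ((1 + H * 2) * ((1 + (H + h) * 2) * 1))) ≡ 1 + (4 * h * h + 7 * h + 2) * (2 * (2 * H))
    identity _ h refl = polynomial h
      where
      polynomial : ∀ h → 1 * ((1 + h * 2) * ((1 + suc h * 2) * ((1 + (suc h + h) * 2) * 1)))
                       ≡ 1 + (4 * h * h + 7 * h + 2) * (2 * (2 * suc h))
      polynomial = solve-∀

  unitProduct≈1 : unitProduct N ≈ 1
  unitProduct≈1 = ≈-trans (unitProduct≈product-of-roots roots roots-unique roots-units roots-square roots-complete) product-roots≈1

  wilson-even : + N ∣ₛ + unitProduct N -ℤ -1ℤ ^ℤ P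
  wilson-even = %≡%⇒∣- N (unitProduct N) 1 unitProduct≈1

wilson-gauss : ∀ q (P-prime : Prime (suc (suc q))) e → let open PrimePower q P-prime e in
               4 < N → + N ∣ₛ + unitProduct N -ℤ -1ℤ ^ℤ P
wilson-gauss zero    _       zero          (s≤s (s≤s ()))
wilson-gauss zero    _       (suc zero)    (s≤s (s≤s (s≤s (s≤s ()))))
wilson-gauss zero    _       (suc (suc k)) _ = PowerOfTwo.wilson-even k
wilson-gauss (suc q) P-prime e             _ = OddPrimePower.wilson-odd q P-prime e

theorem1p1 : (p α e : ℕ) → Prime p → 0 < α → ¬ (p ∣ α) → 0 < e → 4 < p ^ e →
    (+ (p ^ e)) ∣ℤ
      ((+ unitPart p ((α * p ^ (e ∸ 1)) !))
        -ℤ (-1ℤ ^ℤ (p * α)) *ℤ (+ unitPart p ((α * p ^ e) !)))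
theorem1p1 0            _ _       ()
theorem1p1 1            _ _       ()
theorem1p1 (suc (suc q)) _ zero    _       _ _ () _
theorem1p1 (suc (suc q)) α (suc e) P-prime _ _ _  4<N =
  ∣⇒∣ᵤ (∣v-w*u∣w-s⇒∣u-s*v {s = -1ℤ ^ℤ (P * α)} {u = + u (M !)} {v = + u ((α * N) !)} {w = (+ unitProduct N) ^ℤ α}
         (-1^n*-1^n≡1 (P * α)) u[αN!]≡wᵅu[M!] wᵅ≡[-1]^[Pα])
  where
  open PrimePower q P-prime e
  M = α * P ^ e
  wᵅ≡[-1]^[Pα] : + N ∣ₛ (+ unitProduct N) ^ℤ α -ℤ -1ℤ ^ℤ (P * α)
  wᵅ≡[-1]^[Pα] = subst (λ s → + N ∣ₛ (+ unitProduct N) ^ℤ α -ℤ s) (ℤ.^-*-assoc -1ℤ P α)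
                      (∣m-n⇒∣mᵏ-nᵏ {b = -1ℤ ^ℤ P} α (wilson-gauss q P-prime e 4<N))
  u[αN!]≡wᵅu[M!] : + N ∣ₛ + u ((α * N) !) -ℤ (+ unitProduct N) ^ℤ α *ℤ + u (M !)
  u[αN!]≡wᵅu[M!] = subst (λ x → + N ∣ₛ + u ((α * N) !) -ℤ x)
                        (trans (ℤ.pos-* (unitProduct N ^ α) (u (M !))) (cong (_*ℤ + u (M !)) (pos-^ (unitProduct N) α)))
                        (%≡%⇒∣- N _ _ (u-[α*N]! α))
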